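{- Let $n\ge5$ and let $w=w_1w_2\cdots w_n\in S_n$ satisfy $Q(w)=\widehat Q$. Then: (1) $w_3<w_4<\cdots<w_{n-1}$; (2) $w_n<w_2$; (3) $w_1<w_2$; (4) $w_3<w_1$; (5) $w_3<w_2$; (6) $w_4<w_2$.
   Context: For $n\ge5$, $\widehat Q$ is the standard tableau of shape $(n-3,2,1)$ (English notation) whose first row is $1,2,5,6,\dots,n-1$, second row is $3,4$, and third row is $n$. $Q(w)$ denotes the Robinson–Schensted recording tableau of $w$. -}

module Defs where

open import Data.Nat using (ℕ; zero; suc; _+_; _∸_; _<?_)
open import Data.List using (List; []; _∷_; [_]; _++_; map; upTo)
open import Data.Maybe using (Maybe; just; nothing)
open import Data.Product using (_×_; _,_; proj₂)
open import Data.Fin using (Fin; toℕ)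
open import Data.List using (allFin)
open import Relation.Nullary using (yes; no)

-- A tableau is a list of rows (English notation, first row on top).
Tableau : Set
Tableau = List (List ℕ)

rowInsert : ℕ → List ℕ → List ℕ × Maybe ℕ
rowInsert x [] = [ x ] , nothing
rowInsert x (y ∷ ys) with x <? y
... | yes _ = x ∷ ys , just y
... | no _ with rowInsert x ys
...   | r , b = y ∷ r , b

-- Schensted insertion into a tableau; also returns the (0-based) index
-- of the row in which the new box was created.
insert : ℕ → Tableau → Tableau × ℕ
insert x [] = [ [ x ] ] , 0
insert x (r ∷ rs) with rowInsert x r
... | r' , nothing = r' ∷ rs , 0
... | r' , just y with insert y rs
...   | rs' , k = r' ∷ rs' , suc k

addAt : ℕ → ℕ → Tableau → Tableau
addAt zero i [] = [ [ i ] ]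
addAt zero i (r ∷ rs) = (r ++ [ i ]) ∷ rs
addAt (suc k) i [] = [] ∷ addAt k i []
addAt (suc k) i (r ∷ rs) = r ∷ addAt k i rs

-- Robinson–Schensted on a word, processing letters left to right;
-- the letter at position i (1-based) is recorded with entry i.
rsGo : ℕ → List ℕ → Tableau × Tableau → Tableau × Tableau
rsGo i [] PQ = PQ
rsGo i (x ∷ xs) (P , Q) with insert x P
... | P' , k = rsGo (suc i) xs (P' , addAt k i Q)

RS : List ℕ → Tableau × Tableau
RS w = rsGo 1 w ([] , [])

-- The one-line word w₁ w₂ ⋯ wₙ of a map w : Fin n → Fin n
-- (values shifted to 0-based, which does not affect RS).
word : {n : ℕ} → (Fin n → Fin n) → List ℕ
word {n} w = map (λ i → toℕ (w i)) (allFin n)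

recQ : {n : ℕ} → (Fin n → Fin n) → Tableau
recQ w = proj₂ (RS (word w))

-- Q̂ of shape (n-3,2,1): rows 1,2,5,6,…,n-1 / 3,4 / n.
Qhat : ℕ → Tableau
Qhat n = (1 ∷ 2 ∷ map (λ k → 5 + k) (upTo (n ∸ 5))) ∷ (3 ∷ 4 ∷ []) ∷ [ n ] ∷ []

-- Entries of a recording tableau never move, so Q(w) = Q̂ dictates the row in which
-- each insertion creates its box: rows 0, 1, 1 for w₂, w₃, w₄, row 0 for w₅, …, wₙ₋₁
-- and row 2 for wₙ.  A short case analysis of the first four insertions forces
-- w₃ < w₁ ≤ w₂ and w₃ ≤ w₄ < w₂, with insertion tableau [[w₃, w₄], [w₁, w₂]].  Each
-- of w₅, …, wₙ₋₁ is then appended to the first row, hence is at least its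
-- predecessor, and wₙ bumps an entry of the first row which in turn bumps an entry
-- of [w₁, w₂], so wₙ < w₂.  Injectivity of w makes the weak inequalities strict.
module Submission where

open import Data.Empty using (⊥; ⊥-elim)
open import Data.Fin as Fin using (Fin; toℕ; fromℕ<; _<_)
open import Data.Fin.Properties using (fromℕ<-toℕ; toℕ<n; ≤∧≢⇒<)
open import Data.List using (List; []; _∷_; [_]; _++_; applyUpTo; tabulate; length)
open import Data.List.Membership.Propositional using (_∈_)
open import Data.List.Membership.Propositional.Properties using (∈-++⁺ˡ; ∈-++⁺ʳ; ∈-map⁻; ∈-upTo⁻)
open import Data.List.Properties using (++-assoc; ++-identityʳ; applyUpTo-∷ʳ; length-applyUpTo; map-tabulate)
open import Data.List.Relation.Unary.All as All using (All; []; _∷_)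
open import Data.List.Relation.Unary.All.Properties using (applyUpTo⁻)
open import Data.List.Relation.Unary.AllPairs using (AllPairs; []; _∷_)
import Data.List.Relation.Unary.AllPairs.Properties as AllPairs
open import Data.List.Relation.Unary.Any using (here; there)
open import Data.Maybe using (just; nothing)
open import Data.Nat using (ℕ; zero; suc; _+_; _∸_; _≤_; _<?_; s≤s; z≤n)
import Data.Nat as ℕ
open import Data.Nat.Properties
  using (≤-refl; ≤-trans; n≤1+n; <-trans; <-≤-trans; <-irrefl; ≮⇒≥; <⇒≱; <⇒≢; m≤m+n; m<n+m; +-monoʳ-<; +-suc; +-comm; suc-injective)
open import Data.Product using (_×_; _,_; proj₁; proj₂; ∃-syntax)
open import Data.Sum using (_⊎_; inj₁; inj₂)
open import Function.Definitions using (Injective)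
open import Relation.Nullary using (yes; no)
open import Relation.Binary.PropositionalEquality using (_≡_; _≢_; refl; sym; trans; cong; cong₂; subst; subst₂)

open import Defs

-- Opaque, so that unification sees the letter and the state of each step;
-- it is used only through the equations below.
opaque
  recording : ℕ → List ℕ → Tableau × Tableau → Tableau
  recording i xs PQ = proj₂ (rsGo i xs PQ)

  recording-[] : ∀ {i P Q} → recording i [] (P , Q) ≡ Q
  recording-[] = refl

  recording-∷ : ∀ {i x xs P Q} →
    recording i (x ∷ xs) (P , Q) ≡ recording (suc i) xs (proj₁ (insert x P) , addAt (proj₂ (insert x P)) i Q)
  recording-∷ = refl

  recQ-recording : ∀ {n} (w : Fin n → Fin n) → recQ w ≡ recording 1 (word w) ([] , [])
  recQ-recording w = refl

-- Rows are numbered from 0.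
InRow : ℕ → ℕ → Tableau → Set
InRow j k       []      = ⊥
InRow j zero    (r ∷ T) = j ∈ r
InRow j (suc k) (r ∷ T) = InRow j k T

addAt-InRow-new : ∀ k j Q → InRow j k (addAt k j Q)
addAt-InRow-new zero    j []      = here refl
addAt-InRow-new zero    j (r ∷ Q) = ∈-++⁺ʳ r (here refl)
addAt-InRow-new (suc k) j []      = addAt-InRow-new k j []
addAt-InRow-new (suc k) j (r ∷ Q) = addAt-InRow-new k j Q

addAt-InRow : ∀ k i Q {j l} → InRow j l Q → InRow j l (addAt k i Q)
addAt-InRow zero    i (r ∷ Q) {l = zero}  p = ∈-++⁺ˡ p
addAt-InRow zero    i (r ∷ Q) {l = suc l} p = p
addAt-InRow (suc k) i (r ∷ Q) {l = zero}  p = p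
addAt-InRow (suc k) i (r ∷ Q) {l = suc l} p = addAt-InRow k i Q p

recording-InRow : ∀ i xs P Q {j l} → InRow j l Q → InRow j l (recording i xs (P , Q))
recording-InRow i []       P Q p = subst (InRow _ _) (sym recording-[]) p
recording-InRow i (x ∷ xs) P Q p = subst (InRow _ _) (sym recording-∷)
  (recording-InRow (suc i) xs (proj₁ (insert x P)) _ (addAt-InRow (proj₂ (insert x P)) i Q p))

advance : ∀ {i x xs P Q T} → recording i (x ∷ xs) (P , Q) ≡ T →
  recording (suc i) xs (proj₁ (insert x P) , addAt (proj₂ (insert x P)) i Q) ≡ T
advance h = trans (sym recording-∷) h

advance-by : ∀ {i x xs P Q T P′ k} → recording i (x ∷ xs) (P , Q) ≡ T → insert x P ≡ (P′ , k) →
  recording (suc i) xs (P′ , addAt k i Q) ≡ T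
advance-by {i} {xs = xs} {Q = Q} h eq =
  trans (cong (λ s → recording (suc i) xs (proj₁ s , addAt (proj₂ s) i Q)) (sym eq)) (advance h)

-- Recorded entries never move, so the row in which step i creates its box
-- can be read off the final recording tableau.
recorded-row : ∀ {i x xs P Q T} → recording i (x ∷ xs) (P , Q) ≡ T → InRow i (proj₂ (insert x P)) T
recorded-row {i} {x} {xs} {P} {Q} h =
  subst (InRow i _) (advance h) (recording-InRow (suc i) xs _ _ (addAt-InRow-new (proj₂ (insert x P)) i Q))

rowInsert-append : ∀ x r {r′} → rowInsert x r ≡ (r′ , nothing) → r′ ≡ r ++ [ x ] × All (_≤ x) r
rowInsert-append x []       refl = refl , []
rowInsert-append x (y ∷ ys) eq with x <? y
rowInsert-append x (y ∷ ys) () | yes _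
rowInsert-append x (y ∷ ys) eq | no x≮y with rowInsert x ys in eq′
rowInsert-append x (y ∷ ys) refl | no x≮y | _ , nothing =
  let r′≡ , ys≤x = rowInsert-append x ys eq′ in cong (y ∷_) r′≡ , ≮⇒≥ x≮y ∷ ys≤x
rowInsert-append x (y ∷ ys) () | no x≮y | _ , just _

rowInsert-bump : ∀ x r {r′ y} → rowInsert x r ≡ (r′ , just y) → ℕ._<_ x y × y ∈ r
rowInsert-bump x []       ()
rowInsert-bump x (y ∷ ys) eq with x <? y
rowInsert-bump x (y ∷ ys) refl | yes x<y = x<y , here refl
rowInsert-bump x (y ∷ ys) eq   | no _ with rowInsert x ys in eq′
rowInsert-bump x (y ∷ ys) ()   | no _ | _ , nothing
rowInsert-bump x (y ∷ ys) refl | no _ | _ , just _ =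
  let x<z , z∈ys = rowInsert-bump x ys eq′ in x<z , there z∈ys

insert-first-row : ∀ x r R → proj₂ (insert x (r ∷ R)) ≡ 0 →
  All (_≤ x) r × insert x (r ∷ R) ≡ ((r ++ [ x ]) ∷ R , 0)
insert-first-row x r R k≡0 with rowInsert x r in eq
... | _ , nothing = let r′≡ , r≤x = rowInsert-append x r eq in r≤x , cong (λ r′ → r′ ∷ R , 0) r′≡
insert-first-row x r R () | _ , just _

insert-bumps : ∀ x r R {k} → proj₂ (insert x (r ∷ R)) ≡ suc k →
  ∃[ y ] ℕ._<_ x y × y ∈ r × proj₂ (insert y R) ≡ k
insert-bumps x r R k≡ with rowInsert x r in eq
insert-bumps x r R () | _ , nothing
insert-bumps x r R refl | _ , just y = let x<y , y∈r = rowInsert-bump x r eq in y , x<y , y∈r , refl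

Qhat-first-row⁻ : ∀ {j m} → InRow j 0 (Qhat (5 + m)) → ℕ._<_ j 3 ⊎ (5 ≤ j × ℕ._<_ j (5 + m))
Qhat-first-row⁻ (here refl)         = inj₁ (s≤s (s≤s z≤n))
Qhat-first-row⁻ (there (here refl)) = inj₁ (s≤s (s≤s (s≤s z≤n)))
Qhat-first-row⁻ {m = m} (there (there j∈)) with ∈-map⁻ (5 +_) j∈
... | k , k∈ , refl = inj₂ (m≤m+n 5 k , +-monoʳ-< 5 (∈-upTo⁻ k∈))

Qhat-row-2 : ∀ {k m} → InRow 2 k (Qhat (5 + m)) → k ≡ 0
Qhat-row-2 {zero}              _ = refl
Qhat-row-2 {suc zero}          (there (there ()))
Qhat-row-2 {suc (suc zero)}    (here ())
Qhat-row-2 {suc (suc zero)}    (there ())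
Qhat-row-2 {suc (suc (suc _))} ()

Qhat-row-3-4 : ∀ {j k m} → j ∈ 3 ∷ 4 ∷ [] → InRow j k (Qhat (5 + m)) → k ≡ 1
Qhat-row-3-4 {k = zero} (here refl) j∈ with Qhat-first-row⁻ j∈
... | inj₁ (s≤s (s≤s (s≤s ())))
... | inj₂ (s≤s (s≤s (s≤s ())) , _)
Qhat-row-3-4 {k = zero} (there (here refl)) j∈ with Qhat-first-row⁻ j∈
... | inj₁ (s≤s (s≤s (s≤s ())))
... | inj₂ (s≤s (s≤s (s≤s (s≤s ()))) , _)
Qhat-row-3-4 {k = suc zero}          _                   _ = refl
Qhat-row-3-4 {k = suc (suc zero)}    (here refl)         (here ())
Qhat-row-3-4 {k = suc (suc zero)}    (there (here refl)) (here ())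
Qhat-row-3-4 {k = suc (suc zero)}    _                   (there ())
Qhat-row-3-4 {k = suc (suc (suc _))} _                   ()

Qhat-row-middle : ∀ {j k m} → 5 ≤ j → ℕ._<_ j (5 + m) → InRow j k (Qhat (5 + m)) → k ≡ 0
Qhat-row-middle {k = zero}              _   _   _                   = refl
Qhat-row-middle {k = suc zero}          5≤j _   (here refl)         = ⊥-elim (<⇒≱ (s≤s (s≤s (s≤s (s≤s z≤n)))) 5≤j)
Qhat-row-middle {k = suc zero}          5≤j _   (there (here refl)) = ⊥-elim (<⇒≱ ≤-refl 5≤j)
Qhat-row-middle {k = suc zero}          _   _   (there (there ()))
Qhat-row-middle {k = suc (suc zero)}    _   j<n (here refl)         = ⊥-elim (<-irrefl refl j<n)
Qhat-row-middle {k = suc (suc zero)}    _   _   (there ())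
Qhat-row-middle {k = suc (suc (suc _))} _   _   ()

Qhat-row-last : ∀ {k m} → InRow (5 + m) k (Qhat (5 + m)) → k ≡ 2
Qhat-row-last {zero} n∈ with Qhat-first-row⁻ n∈
... | inj₁ n<3       = ⊥-elim (<⇒≱ n<3 (m≤m+n 3 _))
... | inj₂ (_ , n<n) = ⊥-elim (<-irrefl refl n<n)
Qhat-row-last {suc zero}          (here ())
Qhat-row-last {suc zero}          (there (here ()))
Qhat-row-last {suc zero}          (there (there ()))
Qhat-row-last {suc (suc zero)}    _ = refl
Qhat-row-last {suc (suc (suc _))} ()

four-insertions : ∀ a b c d → let P₃ = proj₁ (insert b ((a ∷ []) ∷ [])) ; P₄ = proj₁ (insert c P₃) in
  proj₂ (insert b ((a ∷ []) ∷ [])) ≡ 0 → proj₂ (insert c P₃) ≡ 1 → proj₂ (insert d P₄) ≡ 1 →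
  ℕ._<_ c a × a ≤ b × c ≤ d × ℕ._<_ d b × insert d P₄ ≡ ((c ∷ d ∷ []) ∷ (a ∷ b ∷ []) ∷ [] , 1)
four-insertions a b c d k₂ k₃ k₄ with b <? a
... | yes _ with () ← k₂
... | no b≮a with c <? a
...   | yes c<a with d <? c
...     | yes _ =
  -- d bumps c, which would have to come to rest after a in the second row
  ⊥-elim (<⇒≱ c<a (All.head (proj₁ (insert-first-row c (a ∷ []) [] (suc-injective k₄)))))
...     | no d≮c with d <? b
...       | no _ with () ← k₄
...       | yes d<b =
  c<a , ≮⇒≥ b≮a , ≮⇒≥ d≮c , d<b ,
  cong (λ s → (c ∷ d ∷ []) ∷ proj₁ s , suc (proj₂ s)) (proj₂ (insert-first-row b (a ∷ []) [] (suc-injective k₄)))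
four-insertions a b c d k₂ k₃ k₄ | no b≮a | no c≮a with c <? b
... | no _ with () ← k₃
... | yes c<b =
  -- d bumps an entry y ≤ c of the first row, which would have to come to rest after b
  let y , _ , y∈ , y-row = insert-bumps d (a ∷ c ∷ []) ((b ∷ []) ∷ []) k₄
      b≤y = All.head (proj₁ (insert-first-row y (b ∷ []) [] y-row))
  in ⊥-elim (<⇒≱ c<b (≤-trans b≤y (All.lookup {P = _≤ c} (≮⇒≥ c≮a ∷ ≤-refl ∷ []) y∈)))

-- Every letter but the last is appended to the first row; the last one creates
-- the third row, so it bumps an entry of the first row, which bumps one of [a , b].
remaining-insertions : ∀ {m a b} ys e {i r Q} → a ≤ b → AllPairs _≤_ r → 5 ≤ i → length ys + i ≡ 5 + m →
  recording i (ys ++ [ e ]) (r ∷ (a ∷ b ∷ []) ∷ [] , Q) ≡ Qhat (5 + m) →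
  AllPairs _≤_ (r ++ ys) × ℕ._<_ e b
remaining-insertions {a = a} {b} [] e {r = r} a≤b r-sorted _ refl h =
  let y , e<y , _ , y-row = insert-bumps e r ((a ∷ b ∷ []) ∷ []) (Qhat-row-last (recorded-row h))
      z , y<z , z∈ , _ = insert-bumps y (a ∷ b ∷ []) [] y-row
  in subst (AllPairs _≤_) (sym (++-identityʳ r)) r-sorted ,
     <-≤-trans (<-trans e<y y<z) (All.lookup {P = _≤ b} (a≤b ∷ ≤-refl ∷ []) z∈)
remaining-insertions {a = a} {b} (y ∷ ys) e {i} {r} a≤b r-sorted 5≤i len h =
  let i<n = subst (i ℕ.<_) len (m<n+m i (s≤s z≤n))
      r≤y , step = insert-first-row y r ((a ∷ b ∷ []) ∷ []) (Qhat-row-middle 5≤i i<n (recorded-row h))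
      r+y-sorted = AllPairs.++⁺ r-sorted ([] ∷ []) (All.map (_∷ []) r≤y)
      sorted , e<b = remaining-insertions ys e a≤b r+y-sorted (≤-trans 5≤i (n≤1+n i))
                       (trans (+-suc (length ys) i) len) (advance-by h step)
  in subst (AllPairs _≤_) (++-assoc r [ y ] ys) sorted , e<b

Qhat-recording-pattern : (G : ℕ → ℕ) (m : ℕ) → recording 1 (applyUpTo G (5 + m)) ([] , []) ≡ Qhat (5 + m) →
  ℕ._<_ (G 2) (G 0) × G 0 ≤ G 1 × AllPairs _≤_ (applyUpTo (λ k → G (2 + k)) (2 + m))
  × ℕ._<_ (G 3) (G 1) × ℕ._<_ (G (4 + m)) (G 1)
Qhat-recording-pattern G m h =
  let ys = applyUpTo (λ k → G (4 + k)) m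
      h₁ = subst (λ zs → recording 1 (G 0 ∷ G 1 ∷ G 2 ∷ G 3 ∷ zs) ([] , []) ≡ Qhat (5 + m))
                 (sym (applyUpTo-∷ʳ (λ k → G (4 + k)) m)) h
      h₂ = advance h₁
      h₃ = advance h₂
      h₄ = advance h₃
      c<a , a≤b , c≤d , d<b , step₄ =
        four-insertions (G 0) (G 1) (G 2) (G 3) (Qhat-row-2 (recorded-row h₂))
          (Qhat-row-3-4 (here refl) (recorded-row h₃)) (Qhat-row-3-4 (there (here refl)) (recorded-row h₄))
      h₅ = advance-by h₄ step₄
      len = trans (cong (_+ 5) (length-applyUpTo _ m)) (+-comm m 5)
      sorted , e<b = remaining-insertions ys (G (4 + m)) a≤b ((c≤d ∷ []) ∷ [] ∷ []) ≤-refl len h₅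
  in c<a , a≤b , sorted , d<b , e<b

AllPairs-applyUpTo⁻ : ∀ {a ℓ} {A : Set a} {R : A → A → Set ℓ} (f : ℕ → A) n {i j} → AllPairs R (applyUpTo f n) →
  ℕ._<_ i j → ℕ._<_ j n → R (f i) (f j)
AllPairs-applyUpTo⁻ f (suc n) {zero}  {suc j} (fi≤ ∷ _) _ (s≤s j<n) =
  applyUpTo⁻ (λ k → f (suc k)) n fi≤ j<n
AllPairs-applyUpTo⁻ f (suc n) {suc i} {suc j} (_ ∷ sorted) (s≤s i<j) (s≤s j<n) =
  AllPairs-applyUpTo⁻ (λ k → f (suc k)) n sorted i<j j<n

AllPairs-applyUpTo-shift⁻ : ∀ {a ℓ} {A : Set a} {R : A → A → Set ℓ} (f : ℕ → A) o n {i j} → AllPairs R (applyUpTo (λ k → f (o + k)) n) →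
  o ≤ i → ℕ._<_ i j → ℕ._<_ j (o + n) → R (f i) (f j)
AllPairs-applyUpTo-shift⁻ f zero    n sorted _ i<j j<n = AllPairs-applyUpTo⁻ f n sorted i<j j<n
AllPairs-applyUpTo-shift⁻ f (suc o) n sorted (s≤s o≤i) (s≤s i<j) (s≤s j<n) =
  AllPairs-applyUpTo-shift⁻ (λ k → f (suc k)) o n sorted o≤i i<j j<n

extend : ∀ {n} → (Fin n → Fin n) → ℕ → ℕ
extend {n} w p with p <? n
... | yes p<n = toℕ (w (fromℕ< p<n))
... | no _    = 0

extend-toℕ : ∀ {n} (w : Fin n → Fin n) i → extend w (toℕ i) ≡ toℕ (w i)
extend-toℕ {n} w i with toℕ i <? n
... | yes i<n = cong (λ j → toℕ (w j)) (fromℕ<-toℕ i i<n)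
... | no i≮n  = ⊥-elim (i≮n (toℕ<n i))

tabulate-applyUpTo : ∀ {n} (h : Fin n → ℕ) (g : ℕ → ℕ) → (∀ i → h i ≡ g (toℕ i)) → tabulate h ≡ applyUpTo g n
tabulate-applyUpTo {zero}  h g h≗g = refl
tabulate-applyUpTo {suc n} h g h≗g =
  cong₂ _∷_ (h≗g Fin.zero) (tabulate-applyUpTo (λ i → h (Fin.suc i)) (λ k → g (suc k)) (λ i → h≗g (Fin.suc i)))

word-applyUpTo : ∀ {n} (w : Fin n → Fin n) → word w ≡ applyUpTo (extend w) n
word-applyUpTo w =
  trans (map-tabulate (λ i → i) (λ i → toℕ (w i))) (tabulate-applyUpTo _ (extend w) (λ i → sym (extend-toℕ w i)))

recQ-extend : ∀ {n} (w : Fin n → Fin n) → recQ w ≡ recording 1 (applyUpTo (extend w) n) ([] , [])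
recQ-extend w = trans (recQ-recording w) (cong (λ xs → recording 1 xs ([] , [])) (word-applyUpTo w))

extend-<-at : ∀ {n} (w : Fin n → Fin n) {p q} → ℕ._<_ (extend w p) (extend w q) →
  (i j : Fin n) → toℕ i ≡ p → toℕ j ≡ q → w i < w j
extend-<-at w lt i j refl refl = subst₂ ℕ._<_ (extend-toℕ w i) (extend-toℕ w j) lt

extend-≤-at : ∀ {n} (w : Fin n → Fin n) → Injective _≡_ _≡_ w → ∀ {p q} → p ≢ q → extend w p ≤ extend w q →
  (i j : Fin n) → toℕ i ≡ p → toℕ j ≡ q → w i < w j
extend-≤-at w w-inj p≢q le i j refl refl =
  ≤∧≢⇒< (subst₂ _≤_ (extend-toℕ w i) (extend-toℕ w j) le) (λ wi≡wj → p≢q (cong toℕ (w-inj wi≡wj)))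

lemma6p5 : (n : ℕ) → 5 ≤ n → (w : Fin n → Fin n) → Injective _≡_ _≡_ w →
    recQ w ≡ Qhat n →
      ((i j : Fin n) → 2 ≤ toℕ i → toℕ i Data.Nat.< toℕ j → toℕ j ≤ n ∸ 2 → w i < w j)
      × ((i j : Fin n) → toℕ i ≡ n ∸ 1 → toℕ j ≡ 1 → w i < w j)
      × ((i j : Fin n) → toℕ i ≡ 0 → toℕ j ≡ 1 → w i < w j)
      × ((i j : Fin n) → toℕ i ≡ 2 → toℕ j ≡ 0 → w i < w j)
      × ((i j : Fin n) → toℕ i ≡ 2 → toℕ j ≡ 1 → w i < w j)
      × ((i j : Fin n) → toℕ i ≡ 3 → toℕ j ≡ 1 → w i < w j)
lemma6p5 .(5 + m) (s≤s (s≤s (s≤s (s≤s (s≤s {n = m} z≤n))))) w w-inj hQ =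
  let w₃<w₁ , w₁≤w₂ , sorted , w₄<w₂ , wₙ<w₂ = Qhat-recording-pattern (extend w) m (trans (sym (recQ-extend w)) hQ) in
  (λ i j 2≤i i<j j≤n-2 → extend-≤-at w w-inj (<⇒≢ i<j)
     (AllPairs-applyUpTo-shift⁻ (extend w) 2 (2 + m) sorted 2≤i i<j (s≤s j≤n-2)) i j refl refl)
  , extend-<-at w wₙ<w₂
  , extend-≤-at w w-inj (λ ()) w₁≤w₂
  , extend-<-at w w₃<w₁
  , extend-<-at w (<-≤-trans w₃<w₁ w₁≤w₂)
  , extend-<-at w w₄<w₂
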